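{- Let $R\in\mathfrak{T}_a\cap\mathfrak{D}_r$ with $R_\times=R^*$. Then $R\in\mathfrak{R}$, and for every $G\in\mathfrak{T}_a$ with $\mathcal{S}(G,R)\ne\emptyset$ and every nonempty set $\mathcal{L}$ of subgraphs of $G$, $$\mathcal{M}^{\mathcal{L}}(G,R)=\{\xi\in\mathcal{H}(G,R):\xi|_L\in\mathcal{S}(L,R)\text{ for all }L\in\mathcal{L}\}.$$ In particular, $$\mathcal{M}(G,R)=\{\xi\in\mathcal{H}(G,R):\iota_\xi(v,w)=2\text{ for all }vw\in A(G^*)\}=\mathcal{S}(G,R).$$
   Context: A digraph $G=(V(G),A(G))$ has finite nonempty vertex set and arc set $A(G)\subseteq V(G)\times V(G)$; $vw$ denotes $(v,w)$; $G^*$ is $G$ with loops removed. $\mathfrak{D}_r$: reflexive digraphs; $\mathfrak{T}_a$: digraphs with $G^*$ acyclic. $\mathcal{H}(G,H)$: homomorphisms; $\mathcal{S}(G,H)=\mathcal{H}(G,H)\cap\mathcal{H}(G^*,H^*)$. Subgraph $L\subseteq G$: $V(L)\subseteq V(G)$, $A(L)\subseteq A(G)$; $\xi|_L$ is the restriction to $V(L)$. For $G\in\mathfrak{T}_a$, $G_\times$ is the digraph on $V(G)$ whose arcs are the $vw\in A(G^*)$ with no directed walk of length $\ge2$ in $G^*$ from $v$ to $w$. A path is a sequence $P_0,\dots,P_{\ell(P)}$ of distinct vertices with $P_{i-1}P_i\in A(G)$; $h_G$: largest path length; $\mathcal{P}^h_G$: paths of length $h_G$; $P_\times$: digraph on $\{P_0,\dots,P_{\ell(P)}\}$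 with arcs $P_{i-1}P_i$; $\mathcal{L}(G)=\{P_\times:P\in\mathcal{P}^h_G\}$. $[v,w]_H=\{u:vu,uw\in A(H)\}$, $\iota(v,w)_H=\#[v,w]_H$; for $\xi\in\mathcal{H}(G,H)$, $\iota_\xi(v,w)=\iota(\xi(v),\xi(w))_H$, $\mu_\xi(L)=\sum_{vw\in A(L^*)}\iota_\xi(v,w)$; $\mathcal{M}(L,H)$: maximizers of $\mu_\xi(L)$ over $\mathcal{H}(L,H)$; $\mathcal{M}^{\mathcal{L}}(G,H)=\{\xi\in\mathcal{H}(G,H):\xi|_L\in\mathcal{M}(L,H)\ \forall L\in\mathcal{L}\}$. $\mathfrak{R}$: the class of $R\in\mathfrak{T}_a\cap\mathfrak{D}_r$ with $\mathcal{M}^{\mathcal{L}(R)}(R,R)\cap\mathcal{S}(R,R)\ne\emptyset$. -}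

module Defs where

open import Data.Nat using (ℕ; zero; suc; _+_; _≤_)
open import Data.Fin using (Fin; toℕ; inject₁)
open import Data.Fin.Properties using (_≟_)
open import Data.Bool using (Bool; true; false; _∧_; not; if_then_else_)
open import Data.List using (List; map; allFin)
open import Data.Nat.ListAction using (sum)
open import Data.Product using (Σ; _×_; ∃)
open import Relation.Nullary using (¬_; ⌊_⌋)
open import Relation.Binary.PropositionalEquality using (_≡_; _≢_; refl)
open import Data.Product using (_,_)
open import Function using (_∘_)
open import Function.Definitions using (Injective)
open import Function.Bundles using (_⇔_)

-- Finite nonempty digraphs: vertex set Fin (suc n), arc set given by a
-- Boolean adjacency function (loops allowed).

record Digraph : Set where
  field
    n   : ℕ
    arc : Fin (suc n) → Fin (suc n) → Bool

open Digraph public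

V : Digraph → Set
V G = Fin (suc (n G))

Arc : (G : Digraph) → V G → V G → Set
Arc G v w = arc G v w ≡ true

Arc* : (G : Digraph) → V G → V G → Set
Arc* G v w = Arc G v w × v ≢ w

arc* : (G : Digraph) → V G → V G → Bool
arc* G v w = arc G v w ∧ not ⌊ v ≟ w ⌋

data Walk* (G : Digraph) : V G → V G → ℕ → Set where
  nil  : ∀ {v} → Walk* G v v zero
  cons : ∀ {u v w k} → Arc* G u v → Walk* G v w k → Walk* G u w (suc k)

Reflexive : Digraph → Set
Reflexive G = ∀ v → Arc G v v

Acyclic : Digraph → Set
Acyclic G = ∀ v k → ¬ Walk* G v v (suc k)

Arc× : (G : Digraph) → V G → V G → Set
Arc× G v w = Arc* G v w × (∀ k → ¬ Walk* G v w (suc (suc k)))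

Times≡Star : Digraph → Set
Times≡Star G = ∀ v w → Arc× G v w ⇔ Arc* G v w

IsHom : (G H : Digraph) → (V G → V H) → Set
IsHom G H ξ = ∀ v w → Arc G v w → Arc H (ξ v) (ξ w)

IsHom* : (G H : Digraph) → (V G → V H) → Set
IsHom* G H ξ = ∀ v w → Arc* G v w → Arc* H (ξ v) (ξ w)

IsStrict : (G H : Digraph) → (V G → V H) → Set
IsStrict G H ξ = IsHom G H ξ × IsHom* G H ξ

ι : (H : Digraph) → V H → V H → ℕ
ι H v w = sum (map (λ u → if arc H v u ∧ arc H u w then 1 else 0) (allFin (suc (n H))))

ι[_] : {G H : Digraph} → (V G → V H) → V G → V G → ℕ
ι[_] {G} {H} ξ v w = ι H (ξ v) (ξ w)

μ : (L H : Digraph) → (V L → V H) → ℕ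
μ L H ξ = sum (map (λ v → sum (map (λ w →
            if arc* L v w then ι H (ξ v) (ξ w) else 0)
          (allFin (suc (n L))))) (allFin (suc (n L))))

IsMax : (L H : Digraph) → (V L → V H) → Set
IsMax L H ξ = IsHom L H ξ × (∀ ζ → IsHom L H ζ → μ L H ζ ≤ μ L H ξ)

-- Subgraphs L ⊆ G, given by a digraph L together with an injective map
-- V(L) → V(G) (identifying V(L) with a subset of V(G)) carrying arcs of
-- L to arcs of G.

record Subgraph (G : Digraph) : Set where
  field
    graph : Digraph
    emb   : V graph → V G
    emb-injective : Injective _≡_ _≡_ emb
    emb-arc : ∀ v w → Arc graph v w → Arc G (emb v) (emb w)

open Subgraph public

restrict : {G : Digraph} {B : Set} → (L : Subgraph G) → (V G → B) → V (graph L) → B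
restrict L ξ = ξ ∘ emb L

-- 𝓜^𝓛(G,H) for a set 𝓛 of subgraphs, presented as an indexed family
IsMaxOn : (G H : Digraph) {I : Set} → (I → Subgraph G) → (V G → V H) → Set
IsMaxOn G H ℒ ξ = IsHom G H ξ × (∀ i → IsMax (graph (ℒ i)) H (restrict (ℒ i) ξ))

record Path (G : Digraph) : Set where
  field
    len   : ℕ
    vert  : Fin (suc len) → V G
    distinct : Injective _≡_ _≡_ vert
    step  : ∀ (i : Fin len) → Arc G (vert (inject₁ i)) (vert (Fin.suc i))

open Path public

IsLongest : (G : Digraph) → Path G → Set
IsLongest G P = ∀ (Q : Path G) → len Q ≤ len P

LongestPath : Digraph → Set
LongestPath G = Σ (Path G) (IsLongest G)

isSucc : ∀ {ℓ} → Fin (suc ℓ) → Fin (suc ℓ) → Bool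
isSucc {zero} _ _ = false
isSucc {suc ℓ} Fin.zero Fin.zero = false
isSucc {suc ℓ} Fin.zero (Fin.suc Fin.zero) = true
isSucc {suc ℓ} Fin.zero (Fin.suc (Fin.suc _)) = false
isSucc {suc ℓ} (Fin.suc _) Fin.zero = false
isSucc {suc ℓ} (Fin.suc i) (Fin.suc j) = isSucc i j

-- the digraph underlying P_× : vertices P_0..P_ℓ, arcs P_{i-1} P_i
pathDigraph : ℕ → Digraph
pathDigraph ℓ = record
  { n = ℓ
  ; arc = λ i j → isSucc i j }

private
  isSucc-sound : ∀ {ℓ} (i j : Fin (suc ℓ)) → isSucc i j ≡ true →
                 Σ (Fin ℓ) (λ k → inject₁ k ≡ i × Fin.suc k ≡ j)
  isSucc-sound {suc ℓ} Fin.zero (Fin.suc Fin.zero) refl = Fin.zero , refl , refl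
  isSucc-sound {suc ℓ} Fin.zero (Fin.suc (Fin.suc j)) ()
  isSucc-sound {suc ℓ} (Fin.suc i) (Fin.suc j) e with isSucc-sound i j e
  ... | k , refl , refl = Fin.suc k , refl , refl
  isSucc-sound {suc ℓ} Fin.zero Fin.zero ()
  isSucc-sound {suc ℓ} (Fin.suc i) Fin.zero ()
  isSucc-sound {zero} Fin.zero Fin.zero ()

pathSub : {G : Digraph} → Path G → Subgraph G
pathSub {G} P = record
  { graph = pathDigraph (len P)
  ; emb = vert P
  ; emb-injective = distinct P
  ; emb-arc = λ i j a → go i j (isSucc-sound i j a) }
  where
  go : ∀ i j → Σ (Fin (len P)) (λ k → inject₁ k ≡ i × Fin.suc k ≡ j) →
       Arc G (vert P i) (vert P j)
  go _ _ (k , refl , refl) = step P k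

-- 𝓛(G) = { P_× : P ∈ 𝓟^h_G }, as a family indexed by longest paths
𝓛 : (G : Digraph) → LongestPath G → Subgraph G
𝓛 G (P , _) = pathSub P

InClassR : Digraph → Set
InClassR R = Acyclic R × Reflexive R ×
  Σ (V R → V R) (λ ξ → IsMaxOn R R (𝓛 R) ξ × IsStrict R R ξ)

module Submission where

-- The whole theorem rests
-- on one computation: the interval [a,a]_R is {a} (acyclicity forbids
-- 2-cycles) and, for an arc ab of R*, [a,b]_R is {a,b} (R_× = R* forbids
-- detours of length 2).  So ι_R is 1 on loops and 2 on arcs of R*.
--
-- Consequently, for any digraph L and homomorphism ζ : L → R, each term of
-- μ_ζ(L) is at most 2 per arc of L*, with equality everywhere exactly when ζ
-- is strict (ι = 2 separates the endpoints).  Whenever some strict L → R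
-- exists, this bound is attained, so the maximisers of μ are precisely the
-- strict homomorphisms.  Since strict maps restrict to strict maps on
-- subgraphs, the same holds for every family of subgraphs of G, and taking
-- G = R, ξ = id shows R ∈ 𝔑.

open import Defs
open import Data.Nat using (ℕ)
open import Data.Product using (Σ; _×_)
open import Relation.Binary.PropositionalEquality using (_≡_)
open import Function.Bundles using (_⇔_)

open import Data.Nat using (zero; suc; _+_; _≤_; z≤n; s≤s)
open import Data.Nat.Properties
  using (+-0-commutativeMonoid; +-identityʳ; +-mono-≤; +-mono-<-≤; +-cancelˡ-≤;
         ≤-antisym; ≤-reflexive; ≤-trans; ≮⇒≥; <⇒≱)
open import Data.Nat.ListAction using (sum)
open import Data.Fin using (Fin; punchIn; punchOut)
open import Data.Fin.Properties using (_≟_; punchInᵢ≢i; punchIn-injective; punchIn-punchOut)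
open import Data.Bool using (Bool; true; false; _∧_; if_then_else_)
open import Data.List using (map; allFin; tabulate)
open import Data.List.Properties using (map-tabulate)
open import Data.Vec.Functional using (Vector; removeAt)
open import Data.Product using (_,_; proj₁; proj₂; map₂)
open import Relation.Nullary using (¬_; yes; no; contradiction)
open import Relation.Binary.PropositionalEquality
  using (refl; sym; trans; cong; cong₂; subst; subst₂; _≢_; module ≡-Reasoning)
open import Function using (id; _∘_)
open import Function.Bundles using (mk⇔; Equivalence)
import Function.Properties.Equivalence as ⇔
open import Algebra.Properties.CommutativeMonoid.Sum +-0-commutativeMonoid
  using (sum-remove; sum-cong-≗; sum-replicate-zero)
  renaming (sum to ∑)

open ≡-Reasoning

sum-allFin : ∀ m (f : Fin m → ℕ) → sum (map f (allFin m)) ≡ ∑ f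
sum-allFin m f = trans (cong sum (map-tabulate id f)) (sum-tabulate f)
  where
  sum-tabulate : ∀ {k} (g : Fin k → ℕ) → sum (tabulate g) ≡ ∑ g
  sum-tabulate {zero}  g = refl
  sum-tabulate {suc k} g = cong (g Fin.zero +_) (sum-tabulate (g ∘ Fin.suc))

∑-point : ∀ {m} (f : Vector ℕ m) a → (∀ u → u ≢ a → f u ≡ 0) → ∑ f ≡ f a
∑-point {suc m} f a off = begin
  ∑ f                     ≡⟨ sum-remove f ⟩
  f a + ∑ (removeAt f a)  ≡⟨ cong (f a +_) rest-vanishes ⟩
  f a + 0                 ≡⟨ +-identityʳ (f a) ⟩
  f a                     ∎
  where
  rest-vanishes : ∑ (removeAt f a) ≡ 0
  rest-vanishes = trans (sum-cong-≗ (λ j → off (punchIn a j) (punchInᵢ≢i a j)))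
                        (sum-replicate-zero m)

∑-pair : ∀ {m} (f : Vector ℕ (suc m)) a b → a ≢ b →
         (∀ u → u ≢ a → u ≢ b → f u ≡ 0) → ∑ f ≡ f a + f b
∑-pair {m} f a b a≢b off = begin
  ∑ f                     ≡⟨ sum-remove f ⟩
  f a + ∑ (removeAt f a)  ≡⟨ cong (f a +_) (∑-point (removeAt f a) b′ off′) ⟩
  f a + f (punchIn a b′)  ≡⟨ cong (λ u → f a + f u) (punchIn-punchOut a≢b) ⟩
  f a + f b               ∎
  where
  -- b′ is the position of b once a has been removed
  b′ : Fin m
  b′ = punchOut a≢b
  off′ : ∀ j → j ≢ b′ → f (punchIn a j) ≡ 0
  off′ j j≢b′ = off (punchIn a j) (punchInᵢ≢i a j) λ j↦b →
    j≢b′ (punchIn-injective a j b′ (trans j↦b (sym (punchIn-punchOut a≢b))))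

∑-mono : ∀ {m} {f g : Vector ℕ m} → (∀ u → f u ≤ g u) → ∑ f ≤ ∑ g
∑-mono {zero}  f≤g = z≤n
∑-mono {suc m} f≤g = +-mono-≤ (f≤g Fin.zero) (∑-mono (f≤g ∘ Fin.suc))

∑-tight : ∀ {m} {f g : Vector ℕ m} → (∀ u → f u ≤ g u) → ∑ g ≤ ∑ f → ∀ u → f u ≡ g u
∑-tight {suc m} {f} {g} f≤g ∑g≤∑f Fin.zero = head-tight
  where
  head-tight : f Fin.zero ≡ g Fin.zero
  head-tight = ≤-antisym (f≤g Fin.zero) (≮⇒≥ λ f₀<g₀ →
    <⇒≱ (+-mono-<-≤ f₀<g₀ (∑-mono (f≤g ∘ Fin.suc))) ∑g≤∑f)
∑-tight {suc m} {f} {g} f≤g ∑g≤∑f (Fin.suc u) =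
  ∑-tight (f≤g ∘ Fin.suc) tail-bound u
  where
  heads-agree : f Fin.zero ≡ g Fin.zero
  heads-agree = ∑-tight f≤g ∑g≤∑f Fin.zero
  tail-bound : ∑ (g ∘ Fin.suc) ≤ ∑ (f ∘ Fin.suc)
  tail-bound = +-cancelˡ-≤ (g Fin.zero) _ _
    (subst (λ x → ∑ g ≤ x + ∑ (f ∘ Fin.suc)) heads-agree ∑g≤∑f)

∑∑-mono : ∀ {m} {f g : Fin m → Vector ℕ m} → (∀ v w → f v w ≤ g v w) →
          ∑ (λ v → ∑ (f v)) ≤ ∑ (λ v → ∑ (g v))
∑∑-mono f≤g = ∑-mono (λ v → ∑-mono (f≤g v))

∑∑-tight : ∀ {m} {f g : Fin m → Vector ℕ m} → (∀ v w → f v w ≤ g v w) →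
           ∑ (λ v → ∑ (g v)) ≤ ∑ (λ v → ∑ (f v)) → ∀ v w → f v w ≡ g v w
∑∑-tight f≤g tight v = ∑-tight (f≤g v)
  (≤-reflexive (sym (∑-tight (λ v′ → ∑-mono (f≤g v′)) tight v)))

arc*-sound : ∀ L v w → arc* L v w ≡ true → Arc* L v w
arc*-sound L v w vw with arc L v w | v ≟ w
... | true | no v≢w = refl , v≢w

arc*-complete : ∀ L v w → Arc* L v w → arc* L v w ≡ true
arc*-complete L v w (v→w , v≢w) rewrite v→w with v ≟ w
... | yes v≡w = contradiction v≡w v≢w
... | no _    = refl

inInterval : (H : Digraph) → V H → V H → V H → ℕ
inInterval H a b u = if arc H a u ∧ arc H u b then 1 else 0

ι-as-∑ : ∀ H a b → ι H a b ≡ ∑ (inInterval H a b)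
ι-as-∑ H a b = sum-allFin _ (inInterval H a b)

inInterval-hit : ∀ H a b u → Arc H a u → Arc H u b → inInterval H a b u ≡ 1
inInterval-hit H a b u a→u u→b rewrite a→u | u→b = refl

inInterval-miss : ∀ H a b u → ¬ (Arc H a u × Arc H u b) → inInterval H a b u ≡ 0
inInterval-miss H a b u = indicator-off
  where
  indicator-off : ∀ {x y : Bool} → ¬ (x ≡ true × y ≡ true) → (if x ∧ y then 1 else 0) ≡ 0
  indicator-off {false}        _         = refl
  indicator-off {true} {false} _         = refl
  indicator-off {true} {true}  no-detour = contradiction (refl , refl) no-detour

record ThinIntervals (H : Digraph) : Set where
  field
    ι-loop : ∀ a → ι H a a ≡ 1
    ι-arc  : ∀ a b → Arc* H a b → ι H a b ≡ 2

thinIntervals : ∀ H → Acyclic H → Reflexive H → Times≡Star H → ThinIntervals H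
thinIntervals H acyclic loops reduced = record { ι-loop = ι-loop ; ι-arc = ι-arc }
  where
  ι-loop : ∀ a → ι H a a ≡ 1
  ι-loop a = begin
    ι H a a                 ≡⟨ ι-as-∑ H a a ⟩
    ∑ (inInterval H a a)    ≡⟨ ∑-point _ a only-a ⟩
    inInterval H a a a      ≡⟨ inInterval-hit H a a a (loops a) (loops a) ⟩
    1                       ∎
    where
    only-a : ∀ u → u ≢ a → inInterval H a a u ≡ 0
    only-a u u≢a = inInterval-miss H a a u λ (a→u , u→a) →
      acyclic a 1 (cons (a→u , u≢a ∘ sym) (cons (u→a , u≢a) nil))

  ι-arc : ∀ a b → Arc* H a b → ι H a b ≡ 2
  ι-arc a b ab@(a→b , a≢b) = begin
    ι H a b                                   ≡⟨ ι-as-∑ H a b ⟩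
    ∑ (inInterval H a b)                      ≡⟨ ∑-pair _ a b a≢b only-a-b ⟩
    inInterval H a b a + inInterval H a b b   ≡⟨ cong₂ _+_ (inInterval-hit H a b a (loops a) a→b)
                                                          (inInterval-hit H a b b a→b (loops b)) ⟩
    2                                         ∎
    where
    no-long-walk : ∀ k → ¬ Walk* H a b (suc (suc k))
    no-long-walk = proj₂ (Equivalence.from (reduced a b) ab)
    only-a-b : ∀ u → u ≢ a → u ≢ b → inInterval H a b u ≡ 0
    only-a-b u u≢a u≢b = inInterval-miss H a b u λ (a→u , u→b) →
      no-long-walk 0 (cons (a→u , u≢a ∘ sym) (cons (u→b , u≢b) nil))

Saturating : (L H : Digraph) → (V L → V H) → Set
Saturating L H ζ = IsHom L H ζ × (∀ v w → Arc* L v w → ι[_] {L} {H} ζ v w ≡ 2)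

-- The vw-term of μ_ζ(L), and its largest possible value 2·[vw ∈ A(L*)].
weight : (L H : Digraph) → (V L → V H) → V L → V L → ℕ
weight L H ζ v w = if arc* L v w then ι H (ζ v) (ζ w) else 0

capacity : (L : Digraph) → V L → V L → ℕ
capacity L v w = if arc* L v w then 2 else 0

totalCapacity : Digraph → ℕ
totalCapacity L = ∑ (λ v → ∑ (capacity L v))

μ-as-∑∑ : ∀ L H ζ → μ L H ζ ≡ ∑ (λ v → ∑ (weight L H ζ v))
μ-as-∑∑ L H ζ = trans (sum-allFin (suc (n L)) (λ v → sum (map (weight L H ζ v) (allFin (suc (n L))))))
                      (sum-cong-≗ λ v → sum-allFin (suc (n L)) (weight L H ζ v))

module _ {H : Digraph} (thin : ThinIntervals H) where
  open ThinIntervals thin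

  ι≤2 : ∀ a b → Arc H a b → ι H a b ≤ 2
  ι≤2 a b a→b with a ≟ b
  ... | yes refl = ≤-trans (≤-reflexive (ι-loop a)) (s≤s z≤n)
  ... | no a≢b   = ≤-reflexive (ι-arc a b (a→b , a≢b))

  ι≡2⇒≢ : ∀ a b → ι H a b ≡ 2 → a ≢ b
  ι≡2⇒≢ a .a ι≡2 refl with trans (sym (ι-loop a)) ι≡2
  ... | ()

  saturating⇔strict : ∀ L ζ → Saturating L H ζ ⇔ IsStrict L H ζ
  saturating⇔strict L ζ = mk⇔
    (λ (hom , ι≡2) → hom , λ v w vw → hom v w (proj₁ vw) , ι≡2⇒≢ (ζ v) (ζ w) (ι≡2 v w vw))
    (λ (hom , hom*) → hom , λ v w vw → ι-arc (ζ v) (ζ w) (hom* v w vw))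

  weight≤capacity : ∀ L ζ → IsHom L H ζ → ∀ v w → weight L H ζ v w ≤ capacity L v w
  weight≤capacity L ζ hom v w with arc* L v w in vw
  ... | false = z≤n
  ... | true  = ι≤2 (ζ v) (ζ w) (hom v w (proj₁ (arc*-sound L v w vw)))

  saturating⇒weight≡capacity : ∀ L ζ → Saturating L H ζ → ∀ v w → weight L H ζ v w ≡ capacity L v w
  saturating⇒weight≡capacity L ζ (_ , ι≡2) v w with arc* L v w in vw
  ... | false = refl
  ... | true  = ι≡2 v w (arc*-sound L v w vw)

  weight≡capacity⇒ι≡2 : ∀ L ζ v w → Arc* L v w → weight L H ζ v w ≡ capacity L v w →
                        ι[_] {L} {H} ζ v w ≡ 2
  weight≡capacity⇒ι≡2 L ζ v w vw full = begin
    ι H (ζ v) (ζ w)      ≡⟨ cong (λ b → if b then ι H (ζ v) (ζ w) else 0) (arc*-complete L v w vw) ⟨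
    weight L H ζ v w     ≡⟨ full ⟩
    capacity L v w       ≡⟨ cong (λ b → if b then 2 else 0) (arc*-complete L v w vw) ⟩
    2                    ∎

  μ≤totalCapacity : ∀ L ζ → IsHom L H ζ → μ L H ζ ≤ totalCapacity L
  μ≤totalCapacity L ζ hom =
    subst (_≤ totalCapacity L) (sym (μ-as-∑∑ L H ζ)) (∑∑-mono (weight≤capacity L ζ hom))

  μ≡totalCapacity : ∀ L ζ → Saturating L H ζ → μ L H ζ ≡ totalCapacity L
  μ≡totalCapacity L ζ sat =
    trans (μ-as-∑∑ L H ζ) (sum-cong-≗ λ v → sum-cong-≗ (saturating⇒weight≡capacity L ζ sat v))

  -- If some strict homomorphism L → H exists, the maximisers of μ are
  -- exactly the saturating homomorphisms: both attain totalCapacity L.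
  maximiser⇔saturating : ∀ L → Σ (V L → V H) (IsStrict L H) → ∀ ζ → IsMax L H ζ ⇔ Saturating L H ζ
  maximiser⇔saturating L (ξ , ξ-strict) ζ = mk⇔ to from
    where
    ξ-saturating : Saturating L H ξ
    ξ-saturating = Equivalence.from (saturating⇔strict L ξ) ξ-strict

    to : IsMax L H ζ → Saturating L H ζ
    to (hom , maximal) = hom , λ v w vw →
      weight≡capacity⇒ι≡2 L ζ v w vw (∑∑-tight (weight≤capacity L ζ hom) capacity≤μ v w)
      where
      capacity≤μ : totalCapacity L ≤ ∑ (λ v → ∑ (weight L H ζ v))
      capacity≤μ = subst₂ _≤_ (μ≡totalCapacity L ξ ξ-saturating) (μ-as-∑∑ L H ζ)
                          (maximal ξ (proj₁ ξ-strict))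

    from : Saturating L H ζ → IsMax L H ζ
    from sat = proj₁ sat , λ ζ′ hom′ →
      subst (μ L H ζ′ ≤_) (sym (μ≡totalCapacity L ζ sat)) (μ≤totalCapacity L ζ′ hom′)

  maximiser⇔strict : ∀ L → Σ (V L → V H) (IsStrict L H) → ∀ ζ → IsMax L H ζ ⇔ IsStrict L H ζ
  maximiser⇔strict L strict ζ = ⇔.trans (maximiser⇔saturating L strict ζ) (saturating⇔strict L ζ)

-- Strict homomorphisms restrict to strict homomorphisms on subgraphs
-- (injectivity of the embedding keeps non-loops non-loops).
restrict-strict : ∀ {G H} (L : Subgraph G) {ξ} → IsStrict G H ξ → IsStrict (graph L) H (restrict L ξ)
restrict-strict L (hom , hom*) =
  (λ v w v→w → hom _ _ (emb-arc L v w v→w)) ,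
  (λ v w (v→w , v≢w) → hom* _ _ (emb-arc L v w v→w , v≢w ∘ emb-injective L))

maximiserOn⇔strictOn : ∀ {G H} → ThinIntervals H → Σ (V G → V H) (IsStrict G H) →
  ∀ {I : Set} (ℒ : I → Subgraph G) ξ →
  IsMaxOn G H ℒ ξ ⇔ (IsHom G H ξ × (∀ i → IsStrict (graph (ℒ i)) H (restrict (ℒ i) ξ)))
maximiserOn⇔strictOn {G} {H} thin (ξ₀ , ξ₀-strict) ℒ ξ = mk⇔
  (map₂ λ maximal i → Equivalence.to (on i) (maximal i))
  (map₂ λ strict i → Equivalence.from (on i) (strict i))
  where
  on : ∀ i → IsMax (graph (ℒ i)) H (restrict (ℒ i) ξ) ⇔ IsStrict (graph (ℒ i)) H (restrict (ℒ i) ξ)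
  on i = maximiser⇔strict thin (graph (ℒ i)) (restrict (ℒ i) ξ₀ , restrict-strict {G} {H} (ℒ i) ξ₀-strict)
                          (restrict (ℒ i) ξ)

lemma9 : (R : Digraph) → Acyclic R → Reflexive R → Times≡Star R →
    InClassR R
    × ((G : Digraph) → Acyclic G → Σ (V G → V R) (IsStrict G R) →
        ((I : Set) → I → (ℒ : I → Subgraph G) → (ξ : V G → V R) →
          IsMaxOn G R ℒ ξ
            ⇔ (IsHom G R ξ × (∀ i → IsStrict (graph (ℒ i)) R (restrict (ℒ i) ξ))))
        × ((ξ : V G → V R) →
            (IsMax G R ξ ⇔ (IsHom G R ξ × (∀ v w → Arc* G v w → ι[_] {G} {R} ξ v w ≡ 2)))
            × ((IsHom G R ξ × (∀ v w → Arc* G v w → ι[_] {G} {R} ξ v w ≡ 2)) ⇔ IsStrict G R ξ)))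
lemma9 R acyclic loops reduced = R∈𝔑 , λ G _ strict →
    (λ I _ ℒ ξ → maximiserOn⇔strictOn thin strict ℒ ξ) ,
    (λ ξ → maximiser⇔saturating thin G strict ξ , saturating⇔strict thin G ξ)
  where
  thin : ThinIntervals R
  thin = thinIntervals R acyclic loops reduced

  id-strict : IsStrict R R id
  id-strict = (λ _ _ a → a) , (λ _ _ a → a)

  -- the identity maximises μ on every longest path, being strict there
  R∈𝔑 : InClassR R
  R∈𝔑 = acyclic , loops , id ,
    Equivalence.from (maximiserOn⇔strictOn thin (id , id-strict) (𝓛 R) id)
      (proj₁ id-strict , λ P → restrict-strict (𝓛 R P) id-strict) ,
    id-strict
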